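{- Let $G_1$ and $G_2$ be connected graphs of orders $n_1,n_2\geq 2$ respectively, and let $G=G_1+G_2$ be their join, of order $n_3\geq 5$. Then $F_{xt}(G)\leq \min\{F_{xt}(G_1),F_{xt}(G_2)\}$. This bound is sharp.
   Context: All graphs are finite, simple; throughout the paper graphs are assumed connected and symmetric (having a nontrivial automorphism group). A set $F\subseteq V(G)$ is a fixing set of $G$ if the only automorphism of $G$ fixing every vertex of $F$ is the identity. A fixatic partition of $G$ is a partition $\{F_1,\dots,F_k\}$ of $V(G)$ into classes each of which is a fixing set of $G$; the fixatic number $F_{xt}(G)$ is the maximum number of classes in a fixatic partition. The join $G_1+G_2$ is $G_1\cup G_2$ together with all edges between $V(G_1)$ and $V(G_2)$. -}

module Defs where

open import Data.Nat using (ℕ; zero; suc; _+_; _≤_; _⊓_)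
open import Data.Fin using (Fin; splitAt)
open import Data.Bool using (Bool; true; false)
open import Data.Sum using (_⊎_; inj₁; inj₂)
open import Data.Product using (Σ; _×_; _,_; ∃; ∃-syntax)
open import Relation.Binary.PropositionalEquality using (_≡_; _≢_)

record Graph (n : ℕ) : Set where
  field
    adj   : Fin n → Fin n → Bool
    sym   : ∀ u v → adj u v ≡ adj v u
    irrefl : ∀ v → adj v v ≡ false
open Graph public

data Reach {n : ℕ} (G : Graph n) : Fin n → Fin n → Set where
  here : ∀ {v} → Reach G v v
  step : ∀ {u w v} → adj G u w ≡ true → Reach G w v → Reach G u v

Connected : ∀ {n} → Graph n → Set
Connected G = ∀ u v → Reach G u v

record Automorphism {n : ℕ} (G : Graph n) : Set where
  field
    fun     : Fin n → Fin n
    inv     : Fin n → Fin n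
    leftInv  : ∀ v → inv (fun v) ≡ v
    rightInv : ∀ v → fun (inv v) ≡ v
    preserves : ∀ u v → adj G (fun u) (fun v) ≡ adj G u v
open Automorphism public

Symmetric : ∀ {n} → Graph n → Set
Symmetric G = Σ (Automorphism G) λ σ → ∃[ v ] fun σ v ≢ v

FixingSet : ∀ {n} → Graph n → (Fin n → Set) → Set
FixingSet G F = (σ : Automorphism G) → (∀ v → F v → fun σ v ≡ v) → ∀ v → fun σ v ≡ v

FixaticPartition : ∀ {n} → Graph n → (k : ℕ) → Set
FixaticPartition {n} G k =
  Σ (Fin n → Fin k) λ c →
    (∀ i → ∃[ v ] c v ≡ i) × (∀ i → FixingSet G (λ v → c v ≡ i))

IsFixaticNumber : ∀ {n} → Graph n → ℕ → Set
IsFixaticNumber G m = FixaticPartition G m × (∀ k → FixaticPartition G k → k ≤ m)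

joinAdj : ∀ {n₁ n₂} → Graph n₁ → Graph n₂ → Fin (n₁ + n₂) → Fin (n₁ + n₂) → Bool
joinAdj {n₁} G₁ G₂ u v with splitAt n₁ u | splitAt n₁ v
... | inj₁ a | inj₁ b = adj G₁ a b
... | inj₂ a | inj₂ b = adj G₂ a b
... | inj₁ _ | inj₂ _ = true
... | inj₂ _ | inj₁ _ = true

joinSym : ∀ {n₁ n₂} (G₁ : Graph n₁) (G₂ : Graph n₂) u v → joinAdj G₁ G₂ u v ≡ joinAdj G₁ G₂ v u
joinSym {n₁} G₁ G₂ u v with splitAt n₁ u | splitAt n₁ v
... | inj₁ a | inj₁ b = sym G₁ a b
... | inj₂ a | inj₂ b = sym G₂ a b
... | inj₁ _ | inj₂ _ = _≡_.refl
... | inj₂ _ | inj₁ _ = _≡_.refl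

joinIrrefl : ∀ {n₁ n₂} (G₁ : Graph n₁) (G₂ : Graph n₂) v → joinAdj G₁ G₂ v v ≡ false
joinIrrefl {n₁} G₁ G₂ v with splitAt n₁ v
... | inj₁ a = irrefl G₁ a
... | inj₂ a = irrefl G₂ a

_⊕_ : ∀ {n₁ n₂} → Graph n₁ → Graph n₂ → Graph (n₁ + n₂)
G₁ ⊕ G₂ = record { adj = joinAdj G₁ G₂ ; sym = joinSym G₁ G₂ ; irrefl = joinIrrefl G₁ G₂ }

JoinHyp : ∀ {n₁ n₂} → Graph n₁ → Graph n₂ → Set
JoinHyp {n₁} {n₂} G₁ G₂ =
  Connected G₁ × Connected G₂ × Symmetric G₁ × Symmetric G₂ ×
  2 ≤ n₁ × 2 ≤ n₂ × 5 ≤ n₁ + n₂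

-- Every automorphism of G₁ extends to an automorphism of G₁ + G₂ that
-- acts as the identity on G₂ (adjacency across the join is unconditional).
-- Consequently the trace on V(G₁) of a fixing set of the join is a fixing set
-- of G₁, and since G₁ is symmetric that trace is never empty.  Restricting a
-- fixatic partition of G₁ + G₂ with k classes to V(G₁) therefore yields a
-- fixatic partition of G₁ with k classes; symmetrically for G₂.
module Submission where

open import Defs
open import Data.Nat using (ℕ; zero; suc; _+_; _≤_; _⊓_; z≤n; s≤s)
open import Data.Nat.Properties using (⊓-glb)
open import Data.Fin using (Fin; zero; suc; splitAt; join; _↑ˡ_; _↑ʳ_)
open import Data.Fin.Patterns using (0F; 1F; 2F)
open import Data.Fin.Properties
  using (_≟_; any?; ↑ˡ-injective; ↑ʳ-injective; splitAt-↑ˡ; splitAt-↑ʳ;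
         splitAt-join; join-splitAt; splitAt⁻¹-↑ˡ; splitAt⁻¹-↑ʳ; 0≢1+n)
import Data.Fin.Permutation.Components as Perm
open import Data.Bool using (Bool; true; false; not)
open import Data.Sum using (_⊎_; inj₁; inj₂)
import Data.Sum as Sum
open import Data.Product using (Σ; _×_; ∃; ∃-syntax; _,_)
open import Function using (_∘_; Injective)
open import Relation.Unary using (Pred; Decidable)
open import Relation.Nullary using (¬_; does; yes; no; contradiction)
open import Relation.Nullary.Decidable using (dec-true; dec-false)
open import Relation.Binary.PropositionalEquality
  using (_≡_; _≢_; refl; trans; cong; cong₂; module ≡-Reasoning)
  renaming (sym to ≡-sym)

idAut : ∀ {n} (G : Graph n) → Automorphism G
idAut G = record
  { fun = λ v → v ; inv = λ v → v
  ; leftInv = λ _ → refl ; rightInv = λ _ → refl ; preserves = λ _ _ → refl }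

-- A decidable fixing set of a symmetric graph is inhabited: if it were empty,
-- every automorphism would fix it pointwise, hence be the identity.
fixingSet-inhabited : ∀ {n} {G : Graph n} {P : Pred (Fin n) _} →
  Symmetric G → Decidable P → FixingSet G P → ∃ P
fixingSet-inhabited (τ , w , τw≢w) P? fixing with any? P?
... | yes found = found
... | no empty  = contradiction (fixing τ (λ v Pv → contradiction (v , Pv) empty) w) τw≢w

trivialPartition : ∀ {n} (G : Graph (suc n)) → FixaticPartition G 1
trivialPartition G =
  (λ _ → zero) , (λ { zero → zero , refl }) , (λ { zero σ fixes v → fixes v refl })

record ExtendingEmbedding {n N} (G : Graph n) (H : Graph N) : Set where
  field
    embed           : Fin n → Fin N
    embed-injective : Injective _≡_ _≡_ embed
    extend          : Automorphism G → Automorphism H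
    extend-embed    : ∀ σ a → fun (extend σ) (embed a) ≡ embed (fun σ a)
    extend-outside  : ∀ σ v → (∃[ a ] embed a ≡ v) ⊎ fun (extend σ) v ≡ v

module _ {n N} {G : Graph n} {H : Graph N} (E : ExtendingEmbedding G H) where
  open ExtendingEmbedding E

  -- The trace of a fixing set of H on G is a fixing set of G: an automorphism
  -- fixing the trace extends to one fixing the whole set, hence the identity.
  trace-fixing : ∀ {P : Pred (Fin N) _} → FixingSet H P → FixingSet G (P ∘ embed)
  trace-fixing {P} fixing σ fixesTrace a = embed-injective (begin
      embed (fun σ a)            ≡⟨ ≡-sym (extend-embed σ a) ⟩
      fun (extend σ) (embed a)   ≡⟨ fixing (extend σ) fixesP (embed a) ⟩
      embed a                    ∎)
    where
    open ≡-Reasoning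
    fixesP : ∀ v → P v → fun (extend σ) v ≡ v
    fixesP v Pv with extend-outside σ v
    ... | inj₁ (b , refl) = trans (extend-embed σ b) (cong embed (fixesTrace b Pv))
    ... | inj₂ fixed      = fixed

  -- Restricting a fixatic partition of H to G gives one with as many classes,
  -- provided G is symmetric (so that no class has an empty trace).
  restrict : Symmetric G → ∀ {k} → FixaticPartition H k → FixaticPartition G k
  restrict symG (c , _ , fixing) =
    c ∘ embed ,
    (λ i → fixingSet-inhabited symG (λ a → c (embed a) ≟ i) (trace-fixing (fixing i))) ,
    (λ i → trace-fixing (fixing i))

  fixatic-monotone : Symmetric G → ∀ {m m′} →
    FixaticPartition H m → IsFixaticNumber G m′ → m ≤ m′
  fixatic-monotone symG part (_ , maximal) = maximal _ (restrict symG part)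

module _ {n₁ n₂} (G₁ : Graph n₁) (G₂ : Graph n₂) where

  sumAdj : Fin n₁ ⊎ Fin n₂ → Fin n₁ ⊎ Fin n₂ → Bool
  sumAdj (inj₁ a) (inj₁ b) = adj G₁ a b
  sumAdj (inj₂ a) (inj₂ b) = adj G₂ a b
  sumAdj (inj₁ _) (inj₂ _) = true
  sumAdj (inj₂ _) (inj₁ _) = true

  joinAdj-split : ∀ u v → joinAdj G₁ G₂ u v ≡ sumAdj (splitAt n₁ u) (splitAt n₁ v)
  joinAdj-split u v with splitAt n₁ u | splitAt n₁ v
  ... | inj₁ _ | inj₁ _ = refl
  ... | inj₂ _ | inj₂ _ = refl
  ... | inj₁ _ | inj₂ _ = refl
  ... | inj₂ _ | inj₁ _ = refl

  joinAut : Automorphism G₁ → Automorphism G₂ → Automorphism (G₁ ⊕ G₂)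
  joinAut σ₁ σ₂ = record
    { fun = onJoin φ ; inv = onJoin ψ
    ; leftInv = roundTrip ψ φ ψφ ; rightInv = roundTrip φ ψ φψ
    ; preserves = preserves′ }
    where
    φ ψ : Fin n₁ ⊎ Fin n₂ → Fin n₁ ⊎ Fin n₂
    φ = Sum.map (fun σ₁) (fun σ₂)
    ψ = Sum.map (inv σ₁) (inv σ₂)

    onJoin : (Fin n₁ ⊎ Fin n₂ → Fin n₁ ⊎ Fin n₂) → Fin (n₁ + n₂) → Fin (n₁ + n₂)
    onJoin f = join n₁ n₂ ∘ f ∘ splitAt n₁

    ψφ : ∀ x → ψ (φ x) ≡ x
    ψφ (inj₁ a) = cong inj₁ (leftInv σ₁ a)
    ψφ (inj₂ b) = cong inj₂ (leftInv σ₂ b)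

    φψ : ∀ x → φ (ψ x) ≡ x
    φψ (inj₁ a) = cong inj₁ (rightInv σ₁ a)
    φψ (inj₂ b) = cong inj₂ (rightInv σ₂ b)

    roundTrip : ∀ f g → (∀ x → f (g x) ≡ x) → ∀ v → onJoin f (onJoin g v) ≡ v
    roundTrip f g fg v = begin
      join n₁ n₂ (f (splitAt n₁ (join n₁ n₂ (g (splitAt n₁ v)))))
        ≡⟨ cong (join n₁ n₂ ∘ f) (splitAt-join n₁ n₂ _) ⟩
      join n₁ n₂ (f (g (splitAt n₁ v)))  ≡⟨ cong (join n₁ n₂) (fg _) ⟩
      join n₁ n₂ (splitAt n₁ v)          ≡⟨ join-splitAt n₁ n₂ v ⟩
      v                                  ∎
      where open ≡-Reasoning

    φ-preserves : ∀ x y → sumAdj (φ x) (φ y) ≡ sumAdj x y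
    φ-preserves (inj₁ a) (inj₁ b) = preserves σ₁ a b
    φ-preserves (inj₂ a) (inj₂ b) = preserves σ₂ a b
    φ-preserves (inj₁ _) (inj₂ _) = refl
    φ-preserves (inj₂ _) (inj₁ _) = refl

    preserves′ : ∀ u v → joinAdj G₁ G₂ (onJoin φ u) (onJoin φ v) ≡ joinAdj G₁ G₂ u v
    preserves′ u v = begin
      joinAdj G₁ G₂ (onJoin φ u) (onJoin φ v)
        ≡⟨ joinAdj-split (onJoin φ u) (onJoin φ v) ⟩
      sumAdj (splitAt n₁ (onJoin φ u)) (splitAt n₁ (onJoin φ v))
        ≡⟨ cong₂ sumAdj (splitAt-join n₁ n₂ (φ (splitAt n₁ u)))
                        (splitAt-join n₁ n₂ (φ (splitAt n₁ v))) ⟩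
      sumAdj (φ (splitAt n₁ u)) (φ (splitAt n₁ v))
        ≡⟨ φ-preserves (splitAt n₁ u) (splitAt n₁ v) ⟩
      sumAdj (splitAt n₁ u) (splitAt n₁ v)
        ≡⟨ ≡-sym (joinAdj-split u v) ⟩
      joinAdj G₁ G₂ u v ∎
      where open ≡-Reasoning

  leftPart : ExtendingEmbedding G₁ (G₁ ⊕ G₂)
  leftPart = record
    { embed = _↑ˡ n₂ ; embed-injective = ↑ˡ-injective n₂ _ _
    ; extend = λ σ → joinAut σ (idAut G₂)
    ; extend-embed = λ σ a → cong (join n₁ n₂ ∘ Sum.map (fun σ) (λ b → b)) (splitAt-↑ˡ n₁ a n₂)
    ; extend-outside = outside }
    where
    outside : ∀ σ v → (∃[ a ] a ↑ˡ n₂ ≡ v) ⊎ fun (joinAut σ (idAut G₂)) v ≡ v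
    outside σ v with splitAt n₁ v in eq
    ... | inj₁ a = inj₁ (a , splitAt⁻¹-↑ˡ eq)
    ... | inj₂ b = inj₂ (splitAt⁻¹-↑ʳ eq)

  rightPart : ExtendingEmbedding G₂ (G₁ ⊕ G₂)
  rightPart = record
    { embed = n₁ ↑ʳ_ ; embed-injective = ↑ʳ-injective n₁ _ _
    ; extend = λ σ → joinAut (idAut G₁) σ
    ; extend-embed = λ σ b → cong (join n₁ n₂ ∘ Sum.map (λ a → a) (fun σ)) (splitAt-↑ʳ n₁ n₂ b)
    ; extend-outside = outside }
    where
    outside : ∀ σ v → (∃[ b ] n₁ ↑ʳ b ≡ v) ⊎ fun (joinAut (idAut G₁) σ) v ≡ v
    outside σ v with splitAt n₁ v in eq
    ... | inj₁ a = inj₂ (splitAt⁻¹-↑ˡ eq)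
    ... | inj₂ b = inj₁ (b , splitAt⁻¹-↑ʳ eq)

-- The bound F_xt(G₁ + G₂) ≤ min {F_xt(G₁), F_xt(G₂)}; of the hypotheses only
-- the symmetry of G₁ and G₂ is needed.
joinBound : ∀ {n₁ n₂} (G₁ : Graph n₁) (G₂ : Graph n₂) → JoinHyp G₁ G₂ →
  ∀ m m₁ m₂ → IsFixaticNumber (G₁ ⊕ G₂) m → IsFixaticNumber G₁ m₁ →
  IsFixaticNumber G₂ m₂ → m ≤ m₁ ⊓ m₂
joinBound G₁ G₂ (_ , _ , sym₁ , sym₂ , _) m m₁ m₂ (part , _) num₁ num₂ =
  ⊓-glb (fixatic-monotone (leftPart G₁ G₂) sym₁ part num₁)
        (fixatic-monotone (rightPart G₁ G₂) sym₂ part num₂)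

≟-agree : ∀ {n} {u v x y : Fin n} →
  (u ≡ v → x ≡ y) → (x ≡ y → u ≡ v) → does (u ≟ v) ≡ does (x ≟ y)
≟-agree {u = u} {v} {x} {y} to from with u ≟ v
... | yes u≡v = ≡-sym (dec-true (x ≟ y) (to u≡v))
... | no u≢v  = ≡-sym (dec-false (x ≟ y) (u≢v ∘ from))

Complete : (n : ℕ) → Graph n
Complete n = record
  { adj = λ u v → not (does (u ≟ v))
  ; sym = λ u v → cong not (≟-agree {u = u} {v} {v} {u} ≡-sym ≡-sym)
  ; irrefl = λ v → cong not (dec-true (v ≟ v) refl) }

complete-connected : ∀ {n} → Connected (Complete n)
complete-connected u v with u ≟ v
... | yes refl = here
... | no u≢v   = step (cong not (dec-false (u ≟ v) u≢v)) here

complete-aut : ∀ {n} (f g : Fin n → Fin n) →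
  (∀ v → g (f v) ≡ v) → (∀ v → f (g v) ≡ v) → Automorphism (Complete n)
complete-aut f g gf fg = record
  { fun = f ; inv = g ; leftInv = gf ; rightInv = fg
  ; preserves = λ u v → cong not (≟-agree (f-injective u v) (cong f)) }
  where
  f-injective : ∀ u v → f u ≡ f v → u ≡ v
  f-injective u v fu≡fv = trans (≡-sym (gf u)) (trans (cong g fu≡fv) (gf v))

transposition : ∀ {n} (x y : Fin n) → Automorphism (Complete n)
transposition x y = complete-aut (Perm.transpose x y) (Perm.transpose y x)
  (λ _ → Perm.transpose-inverse y x) (λ _ → Perm.transpose-inverse x y)

transpose-fixes : ∀ {n} {x y v : Fin n} → v ≢ x → v ≢ y → Perm.transpose x y v ≡ v
transpose-fixes {x = x} {y} {v} v≢x v≢y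
  rewrite dec-false (v ≟ x) v≢x | dec-false (v ≟ y) v≢y = refl

transpose-moves : ∀ {n} (x y : Fin n) → Perm.transpose x y x ≡ y
transpose-moves x y rewrite dec-true (x ≟ x) refl = refl

complete-symmetric : ∀ {n} → Symmetric (Complete (suc (suc n)))
complete-symmetric = transposition 0F 1F , 0F , λ ()

-- A fixing set of K_n omits at most one vertex: the transposition of two
-- omitted vertices fixes the set pointwise.
complete-omits-one : ∀ {n} {P : Pred (Fin n) _} {x y : Fin n} →
  FixingSet (Complete n) P → ¬ P x → ¬ P y → x ≡ y
complete-omits-one {P = P} {x} {y} fixing ¬Px ¬Py with x ≟ y
... | yes x≡y = x≡y
... | no x≢y  = contradiction
  (trans (≡-sym (transpose-moves x y)) (fixing (transposition x y) fixesP x))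
  (x≢y ∘ ≡-sym)
  where
  fixesP : ∀ v → P v → Perm.transpose x y v ≡ v
  fixesP v Pv = transpose-fixes (λ { refl → ¬Px Pv }) (λ { refl → ¬Py Pv })

third-vertex : ∀ {n} (x y : Fin (3 + n)) → ∃[ z ] z ≢ x × z ≢ y
third-vertex 0F            0F            = 1F , (λ ()) , (λ ())
third-vertex 0F            1F            = 2F , (λ ()) , (λ ())
third-vertex 0F            (suc (suc _)) = 1F , (λ ()) , (λ ())
third-vertex 1F            0F            = 2F , (λ ()) , (λ ())
third-vertex (suc (suc _)) 0F            = 1F , (λ ()) , (λ ())
third-vertex (suc _)       (suc _)       = 0F , (λ ()) , (λ ())

-- F_xt(K_n) ≤ 1 for n ≥ 3: given vertices x, y in two different classes and a
-- third vertex z, either z and x both miss the class of y, or z and y both miss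
-- the class of x; both contradict complete-omits-one.
complete-fixatic≤1 : ∀ {n k} → 3 ≤ n → FixaticPartition (Complete n) k → k ≤ 1
complete-fixatic≤1 {k = zero}        _ _ = z≤n
complete-fixatic≤1 {k = suc zero}    _ _ = s≤s z≤n
complete-fixatic≤1 {k = suc (suc _)} (s≤s (s≤s (s≤s _))) (c , onto , fixing)
  with onto 0F | onto 1F
... | x , cx≡0 | y , cy≡1 with third-vertex x y
... | z , z≢x , z≢y with c z ≟ 0F
... | yes cz≡0 = contradiction
        (complete-omits-one (fixing 1F) (0≢1+n ∘ trans (≡-sym cx≡0)) (0≢1+n ∘ trans (≡-sym cz≡0)))
        (z≢x ∘ ≡-sym)
... | no cz≢0  = contradiction
        (complete-omits-one (fixing 0F) cz≢0 (0≢1+n ∘ ≡-sym ∘ trans (≡-sym cy≡1)))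
        z≢y

K₃ : Graph 3
K₃ = Complete 3

K₃-fixatic : IsFixaticNumber K₃ 1
K₃-fixatic = trivialPartition K₃ , λ _ → complete-fixatic≤1 (s≤s (s≤s (s≤s z≤n)))

K₃⊕K₃-fixatic : IsFixaticNumber (K₃ ⊕ K₃) 1
K₃⊕K₃-fixatic = trivialPartition (K₃ ⊕ K₃) ,
  λ _ part → fixatic-monotone (leftPart K₃ K₃) complete-symmetric part K₃-fixatic

K₃-joinHyp : JoinHyp K₃ K₃
K₃-joinHyp = complete-connected , complete-connected ,
  complete-symmetric , complete-symmetric ,
  s≤s (s≤s z≤n) , s≤s (s≤s z≤n) , s≤s (s≤s (s≤s (s≤s (s≤s z≤n))))

mainTheorem3 :
    (∀ {n₁ n₂} (G₁ : Graph n₁) (G₂ : Graph n₂) → JoinHyp G₁ G₂ →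
      ∀ m m₁ m₂ → IsFixaticNumber (G₁ ⊕ G₂) m → IsFixaticNumber G₁ m₁ →
      IsFixaticNumber G₂ m₂ → m ≤ m₁ ⊓ m₂)
    ×
    (∃[ n₁ ] ∃[ n₂ ] Σ (Graph n₁) λ G₁ → Σ (Graph n₂) λ G₂ → JoinHyp G₁ G₂ ×
      (∃[ m ] ∃[ m₁ ] ∃[ m₂ ] IsFixaticNumber (G₁ ⊕ G₂) m × IsFixaticNumber G₁ m₁ ×
        IsFixaticNumber G₂ m₂ × m ≡ m₁ ⊓ m₂))
mainTheorem3 =
  joinBound ,
  (3 , 3 , K₃ , K₃ , K₃-joinHyp ,
   1 , 1 , 1 , K₃⊕K₃-fixatic , K₃-fixatic , K₃-fixatic , refl)
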